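{- Let $p\in\mathrm{OFS}(\mathbb{Z}^+)$ and let $j$ with $2\le j\le|p|$ be such that $p_j$ is redundant in $p$. If $q\in\mathrm{OFS}(\mathbb{Z}^+)$ is the sequence obtained by deleting $p_j$ from $p$, then $fw(p)=fw(q)$.
   Context: $\mathrm{OFS}(\mathbb{Z}^+)$ denotes the set of all nonempty strictly increasing finite sequences of positive integers. For $p\in\mathrm{OFS}(\mathbb{Z}^+)$, $|p|$ is its length, $p_i$ its $i$-th entry, $p|_i=(p_1,\ldots,p_i)$, $\gcd(p)$ the gcd of its entries, $\max(p)=p_{|p|}$. The map $R$: $R(p)=p$ if $|p|=1$; if $n=|p|>1$, form $(p_2-p_1,\ldots,p_n-p_1)$ and, if $p_1$ does not appear in it, insert $p_1$ so that the result is strictly increasing. $f$ is defined recursively by $f(p)=p_1$ if $|p|=1$ and $f(p)=p_1+f(R(p))$ if $|p|>1$. $fw$ is defined by: if $n=|p|>1$, $\gcd(p|_{n-1})=\gcd(p)$ and $\max(p)\ge f(p|_{n-1})$, then $fw(p)=fw(p|_{n-1})$; otherwise $fw(p)=f(p)$. For $2\le j\le|p|$, $p_j$ is redundant in $p$ if $\gcd(p|_j)=\gcd(p|_{j-1})$ and $p_j\ge f(p|_{j-1})$. -}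

module Defs where

open import Data.Nat using (ℕ; zero; suc; _+_; _∸_; _≤_; _<_; _≟_; _≤?_; _<?_)
open import Data.Nat.GCD using (gcd)
open import Data.List using (List; []; _∷_; map; foldr; take; drop; length; _++_; last)
open import Data.List.Membership.DecPropositional _≟_ using (_∈?_)
open import Data.List.Relation.Unary.All using (All)
open import Data.List.Relation.Unary.Linked using (Linked)
open import Data.Maybe using (Maybe; just; nothing)
open import Data.Bool using (Bool; true; false; if_then_else_; _∧_)
open import Data.Product using (_×_)
open import Relation.Nullary using (does; ¬_)
open import Relation.Binary.PropositionalEquality using (_≡_)

OFS : List ℕ → Set
OFS p = (¬ p ≡ []) × All (λ x → 1 ≤ x) p × Linked _<_ p

-- max(p) = last entry (0 for the empty list, never used)
maxL : List ℕ → ℕ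
maxL p with last p
... | just x  = x
... | nothing = 0

gcdL : List ℕ → ℕ
gcdL = foldr gcd 0

-- p_i (1-based); 0 if out of range
nth : List ℕ → ℕ → ℕ
nth []       _             = 0
nth (x ∷ xs) zero          = 0
nth (x ∷ xs) (suc zero)    = x
nth (x ∷ xs) (suc (suc i)) = nth xs (suc i)

prefix : ℕ → List ℕ → List ℕ
prefix i p = take i p

insert : ℕ → List ℕ → List ℕ
insert a []       = a ∷ []
insert a (x ∷ xs) = if does (a <? x) then a ∷ x ∷ xs else x ∷ insert a xs

R : List ℕ → List ℕ
R []             = []
R (a ∷ [])       = a ∷ []
R (a ∷ b ∷ rest) =
  let d = map (λ x → x ∸ a) (b ∷ rest) in
  if does (a ∈? d) then d else insert a d

-- f with fuel; on OFS(ℤ⁺) the max strictly decreases under R, so fuel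
-- suc (maxL p) always suffices and the fuel-0 branch is never reached.
fFuel : ℕ → List ℕ → ℕ
fFuel zero     _            = 0
fFuel (suc k)  []           = 0
fFuel (suc k)  (a ∷ [])     = a
fFuel (suc k)  (a ∷ b ∷ ps) = a + fFuel k (R (a ∷ b ∷ ps))

f : List ℕ → ℕ
f p = fFuel (suc (maxL p)) p

-- fw with fuel = length p (each recursive call shortens p by one)
fwFuel : ℕ → List ℕ → ℕ
fwFuel zero    p = f p
fwFuel (suc k) p =
  let n  = length p
      p' = take (n ∸ 1) p in
  if does (2 ≤? n) ∧ does (gcdL p' ≟ gcdL p) ∧ does (f p' ≤? maxL p)
  then fwFuel k p'
  else f p

fw : List ℕ → ℕ
fw p = fwFuel (length p) p

-- p_j is redundant in p (2 ≤ j ≤ |p| assumed separately)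
Redundant : List ℕ → ℕ → Set
Redundant p j = (gcdL (prefix j p) ≡ gcdL (prefix (j ∸ 1) p))
              × (f (prefix (j ∸ 1) p) ≤ nth p j)

-- delete the j-th (1-based) entry
deleteAt : ℕ → List ℕ → List ℕ
deleteAt j p = take (j ∸ 1) p ++ drop j p

-- Write p = a ++ x ∷ b with a = p|_{j-1} and x = p_j; redundancy says gcd (a ∷ʳ x) = gcd a = g
-- and x ≥ f a.  The heart of the proof is the prefix law (f-append): for c with entries ≥ f a,
--   f (a ++ c) = o + f (adjoin g (shift o c)),    o = f a − g,
-- i.e. running R through the prefix a leaves just g in front of the tail lowered by o.  It
-- is proved by following one step of R, by induction on a bound for the entries.  Since g
-- divides x and x ≥ o + g, x − o is a multiple t·g + g, and R lets an adjoined g absorb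
-- such a multiple (multiple-alone, multiple-absorbed).  Hence f (a ∷ʳ x) = x and
-- f (a ++ x ∷ b) = f (a ++ b) for nonempty b.  As fw strips trailing entries while they
-- are redundant, the theorem follows by induction on b from its end: at each step the
-- tests fw performs, and the values of f, agree with and without x.
module Submission where

open import Defs
open import Data.Nat
open import Data.Nat.Properties
open import Data.Nat.Divisibility
open import Data.Nat.GCD using (gcd; gcd[m,n]∣m; gcd[m,n]∣n; gcd-greatest; gcd-identityʳ)
open import Data.List using (List; []; _∷_; map; take; drop; length; _++_; _∷ʳ_)
open import Data.List.Properties using (map-id; map-++; ++-assoc; ++-identityʳ)
open import Data.List.Reverse using (Reverse; []; _∶_∶ʳ_; reverseView)
open import Data.List.Membership.DecPropositional _≟_ using (_∈?_; _∈_)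
open import Data.List.Relation.Unary.All as All using (All; []; _∷_)
import Data.List.Relation.Unary.All.Properties as All
open import Data.List.Relation.Unary.Any using (here; there)
import Data.List.Relation.Unary.Any.Properties as Any
open import Data.List.Relation.Unary.AllPairs as AllPairs using (AllPairs; []; _∷_)
open import Data.List.Relation.Unary.Linked.Properties using (Linked⇒AllPairs)
open import Data.Bool using (Bool; true; false; if_then_else_; _∧_)
open import Data.Product using (_×_; _,_; proj₁; proj₂; Σ-syntax)
open import Data.Sum using (_⊎_; inj₁; inj₂)
open import Relation.Nullary using (does; ¬_; yes; no)
open import Relation.Nullary.Decidable using (dec-true)
open import Relation.Binary.PropositionalEquality
open import Function using (_∘_)
open import Data.Empty using (⊥; ⊥-elim)

-- Strictly increasing lists of positive integers; OFS(ℤ⁺) minus non-emptiness.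
Admissible : List ℕ → Set
Admissible q = AllPairs _<_ q × All (0 <_) q

shift : ℕ → List ℕ → List ℕ
shift a = map (_∸ a)

-- Insert a into d unless already present; so R (a ∷ b ∷ r) = adjoin a (shift a (b ∷ r)).
adjoin : ℕ → List ℕ → List ℕ
adjoin a d = if does (a ∈? d) then d else insert a d

insert-< : ∀ {a x} xs → a < x → insert a (x ∷ xs) ≡ a ∷ x ∷ xs
insert-< {a} {x} xs a<x with a <ᵇ x | <⇒<ᵇ a<x
... | true | _ = refl

insert-≮ : ∀ {a x} xs → ¬ a < x → insert a (x ∷ xs) ≡ x ∷ insert a xs
insert-≮ {a} {x} xs a≮x with a <ᵇ x | <ᵇ⇒< a x
... | false | _ = refl
... | true  | a<x = ⊥-elim (a≮x (a<x _))

insert-below : ∀ a d → All (a <_) d → insert a d ≡ a ∷ d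
insert-below a []       _           = refl
insert-below a (x ∷ xs) (a<x ∷ _) = insert-< xs a<x

insert-above : ∀ a d → All (_< a) d → insert a d ≡ d ∷ʳ a
insert-above a []       _           = refl
insert-above a (x ∷ xs) (x<a ∷ xs<a) rewrite insert-≮ xs (<-asym x<a) =
  cong (x ∷_) (insert-above a xs xs<a)

insert-++ : ∀ a A {C} → All (a <_) C → insert a (A ++ C) ≡ insert a A ++ C
insert-++ a []       a<C = insert-below a _ a<C
insert-++ a (x ∷ xs) {C} a<C with a <? x
... | yes a<x rewrite insert-< (xs ++ C) a<x | insert-< xs a<x = refl
... | no  a≮x rewrite insert-≮ (xs ++ C) a≮x | insert-≮ xs a≮x = cong (x ∷_) (insert-++ a xs a<C)

All-insert⁺ : ∀ {P : ℕ → Set} a d → P a → All P d → All P (insert a d)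
All-insert⁺ a []       pa _           = pa ∷ []
All-insert⁺ a (x ∷ xs) pa (px ∷ pxs) with a <? x
... | yes a<x rewrite insert-< xs a<x = pa ∷ px ∷ pxs
... | no  a≮x rewrite insert-≮ xs a≮x = px ∷ All-insert⁺ a xs pa pxs

All-insert⁻ : ∀ {P : ℕ → Set} a d → All P (insert a d) → P a × All P d
All-insert⁻ a []       (pa ∷ _) = pa , []
All-insert⁻ a (x ∷ xs) ps with a <? x
... | yes a<x rewrite insert-< xs a<x = All.head ps , All.tail ps
... | no  a≮x rewrite insert-≮ xs a≮x =
  let pa , pxs = All-insert⁻ a xs (All.tail ps) in pa , All.head ps ∷ pxs

AllPairs-insert : ∀ a d → AllPairs _<_ d → ¬ a ∈ d → AllPairs _<_ (insert a d)
AllPairs-insert a []       _            _   = [] ∷ []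
AllPairs-insert a (x ∷ xs) (x<xs ∷ inc) a∉ with a <? x
... | yes a<x rewrite insert-< xs a<x = (a<x ∷ All.map (<-trans a<x) x<xs) ∷ x<xs ∷ inc
... | no  a≮x rewrite insert-≮ xs a≮x =
  All-insert⁺ a xs x<a x<xs ∷ AllPairs-insert a xs inc (λ i → a∉ (there i))
  where
  x<a : x < a
  x<a = ≤∧≢⇒< (≮⇒≥ a≮x) (λ x≡a → a∉ (here (sym x≡a)))

adjoin-∈ : ∀ a d → a ∈ d → adjoin a d ≡ d
adjoin-∈ a d a∈d with a ∈? d
... | yes _   = refl
... | no  a∉d = ⊥-elim (a∉d a∈d)

adjoin-∉ : ∀ a d → ¬ a ∈ d → adjoin a d ≡ insert a d
adjoin-∉ a d a∉d with a ∈? d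
... | yes a∈d = ⊥-elim (a∉d a∈d)
... | no  _   = refl

adjoin-below : ∀ a d → All (a <_) d → adjoin a d ≡ a ∷ d
adjoin-below a d a<d =
  trans (adjoin-∉ a d (λ a∈d → <-irrefl refl (All.lookup a<d a∈d))) (insert-below a d a<d)

All-adjoin⁺ : ∀ {P : ℕ → Set} a d → P a → All P d → All P (adjoin a d)
All-adjoin⁺ a d pa pd with a ∈? d
... | yes _ = pd
... | no  _ = All-insert⁺ a d pa pd

All-adjoin⁻ : ∀ {P : ℕ → Set} a d → All P (adjoin a d) → P a × All P d
All-adjoin⁻ a d ps with a ∈? d
... | yes a∈d = All.lookup ps a∈d , ps
... | no  _   = All-insert⁻ a d ps

AllPairs-adjoin : ∀ a d → AllPairs _<_ d → AllPairs _<_ (adjoin a d)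
AllPairs-adjoin a d inc with a ∈? d
... | yes _   = inc
... | no  a∉d = AllPairs-insert a d inc a∉d

adjoin-nonempty : ∀ a d → ¬ adjoin a d ≡ []
adjoin-nonempty a d e = proj₁ (All-adjoin⁻ {P = λ _ → ⊥} a d (subst (All _) (sym e) []))

shift-AllPairs : ∀ a l → All (a <_) l → AllPairs _<_ l → AllPairs _<_ (shift a l)
shift-AllPairs a []       _            _            = []
shift-AllPairs a (x ∷ xs) (a<x ∷ a<xs) (x<xs ∷ inc) =
  All.map⁺ (shifted a<xs x<xs) ∷ shift-AllPairs a xs a<xs inc
  where
  shifted : ∀ {ys} → All (a <_) ys → All (x <_) ys → All (λ y → x ∸ a < y ∸ a) ys
  shifted []         []           = []
  shifted (_ ∷ a<ys) (x<y ∷ x<ys) = ∸-monoˡ-< x<y (<⇒≤ a<x) ∷ shifted a<ys x<ys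

shift-positive : ∀ a l → All (a <_) l → All (0 <_) (shift a l)
shift-positive a []       _            = []
shift-positive a (x ∷ xs) (a<x ∷ a<xs) = m<n⇒0<n∸m a<x ∷ shift-positive a xs a<xs

shift-zero : ∀ c → shift 0 c ≡ c
shift-zero = map-id

shift-+ : ∀ a o c → shift (a + o) c ≡ shift o (shift a c)
shift-+ a o []       = refl
shift-+ a o (x ∷ xs) = cong₂ _∷_ (sym (∸-+-assoc x a o)) (shift-+ a o xs)

shift-lowerBound : ∀ {a m} c → All (λ y → a + m ≤ y) c → All (m ≤_) (shift a c)
shift-lowerBound {a} {m} c h = All.map⁺ (All.map le h)
  where
  le : ∀ {y} → a + m ≤ y → m ≤ y ∸ a
  le {y} a+m≤y = subst (_≤ y ∸ a) (m+n∸m≡n a m) (∸-monoˡ-≤ a a+m≤y)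

R-Admissible : ∀ a b r → Admissible (a ∷ b ∷ r) → Admissible (R (a ∷ b ∷ r))
R-Admissible a b r (a<br ∷ inc , 0<a ∷ _) =
  AllPairs-adjoin a _ (shift-AllPairs a (b ∷ r) a<br inc) ,
  All-adjoin⁺ a _ 0<a (shift-positive a (b ∷ r) a<br)

-- If all entries are ≤ K + 1 then all entries of R are ≤ K: the measure that makes f terminate.
R-bounded : ∀ K a b r → Admissible (a ∷ b ∷ r) → All (_≤ suc K) (a ∷ b ∷ r) →
  All (_≤ K) (R (a ∷ b ∷ r))
R-bounded K a b r ((a<b ∷ _) ∷ _ , 0<a ∷ _) (_ ∷ b≤ ∷ r≤) =
  All-adjoin⁺ a _ (≤-pred (≤-trans a<b b≤)) (All.map⁺ (All.map lower (b≤ ∷ r≤)))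
  where
  lower : ∀ {y} → y ≤ suc K → y ∸ a ≤ K
  lower y≤ = ≤-trans (∸-monoʳ-≤ _ 0<a) (∸-monoˡ-≤ 1 y≤)

no-zero-bound : ∀ {a b r} → Admissible (a ∷ b ∷ r) → ¬ All (_≤ 0) (a ∷ b ∷ r)
no-zero-bound (_ , _ ∷ 0<b ∷ _) (_ ∷ b≤0 ∷ _) = <-irrefl refl (<-≤-trans 0<b b≤0)

fuel-stable : ∀ K q → Admissible q → All (_≤ K) q → ∀ d →
  fFuel (suc K) q ≡ fFuel (suc (d + K)) q
fuel-stable K       []          _  _ d = refl
fuel-stable K       (a ∷ [])    _  _ d = refl
fuel-stable zero    (a ∷ b ∷ r) ad bd d = ⊥-elim (no-zero-bound ad bd)
fuel-stable (suc K) (a ∷ b ∷ r) ad bd d rewrite +-suc d K =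
  cong (a +_) (fuel-stable K (R (a ∷ b ∷ r)) (R-Admissible a b r ad) (R-bounded K a b r ad bd) d)

maxL-upper : ∀ q → AllPairs _<_ q → All (_≤ maxL q) q
maxL-upper []              _                  = []
maxL-upper (x ∷ [])        _                  = ≤-refl ∷ []
maxL-upper (x ∷ y ∷ r) ((x<y ∷ _) ∷ inc) with maxL-upper (y ∷ r) inc
... | y≤ ∷ r≤ = ≤-trans (<⇒≤ x<y) y≤ ∷ y≤ ∷ r≤

maxL-least : ∀ {K} q → All (_≤ K) q → maxL q ≤ K
maxL-least []          _         = z≤n
maxL-least (x ∷ [])    (x≤ ∷ _) = x≤
maxL-least (x ∷ y ∷ r) (_ ∷ bd) = maxL-least (y ∷ r) bd

f-fuel : ∀ K q → Admissible q → All (_≤ K) q → f q ≡ fFuel (suc K) q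
f-fuel K q ad bd =
  trans (fuel-stable (maxL q) q ad (maxL-upper q (proj₁ ad)) (K ∸ maxL q))
        (cong (λ n → fFuel (suc n) q) (m∸n+n≡m (maxL-least q bd)))

f-unfold : ∀ a b r → Admissible (a ∷ b ∷ r) → f (a ∷ b ∷ r) ≡ a + f (R (a ∷ b ∷ r))
f-unfold a b r ad = unfoldAt (maxL (a ∷ b ∷ r)) (maxL-upper _ (proj₁ ad))
  where
  unfoldAt : ∀ M → All (_≤ M) (a ∷ b ∷ r) → fFuel (suc M) (a ∷ b ∷ r) ≡ a + f (R (a ∷ b ∷ r))
  unfoldAt zero    bd = ⊥-elim (no-zero-bound ad bd)
  unfoldAt (suc M) bd =
    cong (a +_) (sym (f-fuel M _ (R-Admissible a b r ad) (R-bounded M a b r ad bd)))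

f-upper : ∀ q → Admissible q → All (_≤ f q) q
f-upper q ad = upperAt (maxL q) q ad (maxL-upper q (proj₁ ad))
  where
  upperAt : ∀ K q → Admissible q → All (_≤ K) q → All (_≤ f q) q
  upperAt K       []          _  _  = []
  upperAt K       (a ∷ [])    _  _  = ≤-refl ∷ []
  upperAt zero    (a ∷ b ∷ r) ad bd = ⊥-elim (no-zero-bound ad bd)
  upperAt (suc K) (a ∷ b ∷ r) ad bd rewrite f-unfold a b r ad =
    m≤m+n a _ ∷ All.map unshift (All.map⁻ shifted≤)
    where
    shifted≤ : All (_≤ f (R (a ∷ b ∷ r))) (shift a (b ∷ r))
    shifted≤ = proj₂ (All-adjoin⁻ a _
      (upperAt K (R (a ∷ b ∷ r)) (R-Admissible a b r ad) (R-bounded K a b r ad bd)))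
    unshift : ∀ {y} → y ∸ a ≤ f (R (a ∷ b ∷ r)) → y ≤ a + f (R (a ∷ b ∷ r))
    unshift {y} le = ≤-trans (m≤n+m∸n y a) (+-monoʳ-≤ a le)

gcdL-divides : ∀ l → All (gcdL l ∣_) l
gcdL-divides []       = []
gcdL-divides (x ∷ xs) =
  gcd[m,n]∣m x (gcdL xs) ∷ All.map (∣-trans (gcd[m,n]∣n x (gcdL xs))) (gcdL-divides xs)

gcdL-greatest : ∀ {d} l → All (d ∣_) l → d ∣ gcdL l
gcdL-greatest []       _           = _ ∣0
gcdL-greatest (x ∷ xs) (d∣x ∷ d∣xs) = gcd-greatest d∣x (gcdL-greatest xs d∣xs)

gcdL-cong : ∀ l l' → (∀ {d} → All (d ∣_) l → All (d ∣_) l') →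
  (∀ {d} → All (d ∣_) l' → All (d ∣_) l) → gcdL l ≡ gcdL l'
gcdL-cong l l' to from =
  ∣-antisym (gcdL-greatest l' (to (gcdL-divides l))) (gcdL-greatest l (from (gcdL-divides l')))

∣-∸ : ∀ {d a y} → a ≤ y → d ∣ a → d ∣ y → d ∣ y ∸ a
∣-∸ {d} {a} a≤y d∣a d∣y = ∣m+n∣m⇒∣n (subst (d ∣_) (sym (m+[n∸m]≡n a≤y)) d∣y) d∣a

-- R does not change the gcd (Euclid's subtraction step).
gcd-R : ∀ a b r → Admissible (a ∷ b ∷ r) → gcdL (R (a ∷ b ∷ r)) ≡ gcdL (a ∷ b ∷ r)
gcd-R a b r (a<br ∷ _ , _) = gcdL-cong _ _ from to
  where
  to : ∀ {d} → All (d ∣_) (a ∷ b ∷ r) → All (d ∣_) (R (a ∷ b ∷ r))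
  to (d∣a ∷ d∣br) =
    All-adjoin⁺ a _ d∣a (All.map⁺ (All.zipWith (λ (a<y , d∣y) → ∣-∸ (<⇒≤ a<y) d∣a d∣y) (a<br , d∣br)))
  from : ∀ {d} → All (d ∣_) (R (a ∷ b ∷ r)) → All (d ∣_) (a ∷ b ∷ r)
  from {d} d∣R with All-adjoin⁻ a _ d∣R
  ... | d∣a , d∣shifted =
    d∣a ∷ All.zipWith (λ (a<y , d∣y-a) → ∣m∸n∣n⇒∣m d (<⇒≤ a<y) d∣y-a d∣a) (a<br , All.map⁻ d∣shifted)

gcd∣f : ∀ q → Admissible q → gcdL q ∣ f q
gcd∣f q ad = divAt (maxL q) q ad (maxL-upper q (proj₁ ad))
  where
  divAt : ∀ K q → Admissible q → All (_≤ K) q → gcdL q ∣ f q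
  divAt K       []          _  _  = ∣-refl
  divAt K       (a ∷ [])    _  _  = gcd[m,n]∣m a 0
  divAt zero    (a ∷ b ∷ r) ad bd = ⊥-elim (no-zero-bound ad bd)
  divAt (suc K) (a ∷ b ∷ r) ad bd rewrite f-unfold a b r ad =
    ∣m∣n⇒∣m+n (All.head (gcdL-divides (a ∷ b ∷ r)))
      (subst (_∣ f (R (a ∷ b ∷ r))) (gcd-R a b r ad)
        (divAt K _ (R-Admissible a b r ad) (R-bounded K a b r ad bd)))

gcd-positive : ∀ q → ¬ q ≡ [] → Admissible q → 0 < gcdL q
gcd-positive []      q≢[] _             = ⊥-elim (q≢[] refl)
gcd-positive (a ∷ l) _    (_ , 0<a ∷ _) =
  n≢0⇒n>0 (λ g≡0 → <-irrefl (sym (0∣⇒≡0 (subst (_∣ a) g≡0 (All.head (gcdL-divides (a ∷ l)))))) 0<a)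

gcd≤f : ∀ q → ¬ q ≡ [] → Admissible q → gcdL q ≤ f q
gcd≤f []      q≢[] _  = ⊥-elim (q≢[] refl)
gcd≤f (a ∷ l) _    ad =
  ∣⇒≤ {{>-nonZero (<-≤-trans (All.head (proj₂ ad)) (All.head (f-upper (a ∷ l) ad)))}}
    (gcd∣f (a ∷ l) ad)

AllPairs-++ˡ : ∀ A {C} → AllPairs _<_ (A ++ C) → AllPairs _<_ A
AllPairs-++ˡ []       _            = []
AllPairs-++ˡ (x ∷ xs) (x<xs ∷ inc) = All.++⁻ˡ xs x<xs ∷ AllPairs-++ˡ xs inc

AllPairs-++ʳ : ∀ A {C} → AllPairs _<_ (A ++ C) → AllPairs _<_ C
AllPairs-++ʳ []       inc       = inc
AllPairs-++ʳ (x ∷ xs) (_ ∷ inc) = AllPairs-++ʳ xs inc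

AllPairs-across : ∀ A {C} → AllPairs _<_ (A ++ C) → All (λ x → All (x <_) C) A
AllPairs-across []       _            = []
AllPairs-across (x ∷ xs) (x<xs ∷ inc) = All.++⁻ʳ xs x<xs ∷ AllPairs-across xs inc

Admissible-++ˡ : ∀ A {C} → Admissible (A ++ C) → Admissible A
Admissible-++ˡ A (inc , pos) = AllPairs-++ˡ A inc , All.++⁻ˡ A pos

Admissible-++ʳ : ∀ A {C} → Admissible (A ++ C) → Admissible C
Admissible-++ʳ A (inc , pos) = AllPairs-++ʳ A inc , All.++⁻ʳ A pos

member-is-head : ∀ {a m} C → AllPairs _<_ C → All (m ≤_) C → a ≤ m → a ∈ C →
  Σ[ ys ∈ List ℕ ] C ≡ a ∷ ys
member-is-head (y ∷ ys) _           _         _   (here refl) = ys , refl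
member-is-head (y ∷ ys) (y<ys ∷ _) (m≤y ∷ _) a≤m (there a∈ys) =
  ⊥-elim (<-irrefl refl (<-≤-trans (All.lookup y<ys a∈ys) (≤-trans a≤m m≤y)))

adjoin-++ : ∀ a A C {m} → AllPairs _<_ (A ++ C) → All (m ≤_) C → a ≤ m →
  (adjoin a (A ++ C) ≡ adjoin a A ++ C) ⊎
  (Σ[ ys ∈ List ℕ ] C ≡ a ∷ ys × a ≡ m × adjoin a (A ++ C) ≡ adjoin a A ++ ys)
adjoin-++ a A C inc m≤C a≤m with a ∈? A
... | yes a∈A = inj₁ (adjoin-∈ a _ (Any.++⁺ˡ a∈A))
... | no a∉A with a ∈? C
...   | no a∉C = inj₁ (begin
        adjoin a (A ++ C) ≡⟨ adjoin-∉ a _ a∉A++C ⟩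
        insert a (A ++ C) ≡⟨ insert-++ a A a<C ⟩
        insert a A ++ C   ∎)
  where
  open ≡-Reasoning
  a∉A++C : ¬ a ∈ A ++ C
  a∉A++C a∈ with Any.++⁻ A a∈
  ... | inj₁ a∈A = a∉A a∈A
  ... | inj₂ a∈C = a∉C a∈C
  a<C : All (a <_) C
  a<C = All.tabulate λ {y} y∈C →
    ≤∧≢⇒< (≤-trans a≤m (All.lookup m≤C y∈C)) (λ a≡y → a∉C (subst (_∈ C) (sym a≡y) y∈C))
...   | yes a∈C with member-is-head C (AllPairs-++ʳ A inc) m≤C a≤m a∈C
...     | ys , refl = inj₂ (ys , refl , ≤-antisym a≤m (All.head m≤C) , (begin
        adjoin a (A ++ a ∷ ys)  ≡⟨ adjoin-∈ a _ (Any.++⁺ʳ A (here refl)) ⟩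
        A ++ a ∷ ys             ≡⟨ sym (++-assoc A (a ∷ []) ys) ⟩
        (A ∷ʳ a) ++ ys          ≡⟨ cong (_++ ys) (sym (insert-above a A A<a)) ⟩
        insert a A ++ ys        ∎))
  where
  open ≡-Reasoning
  A<a : All (_< a) A
  A<a = All.map All.head (AllPairs-across A inc)

adjoin-shift-cancel : ∀ g m ys → g ≤ m → All (m <_) ys →
  adjoin g (shift (m ∸ g) (m ∷ ys)) ≡ adjoin g (shift (m ∸ g) ys)
adjoin-shift-cancel g m ys g≤m m<ys = begin
  adjoin g (shift (m ∸ g) (m ∷ ys)) ≡⟨ cong (λ z → adjoin g (z ∷ shift (m ∸ g) ys)) (m∸[m∸n]≡n g≤m) ⟩
  adjoin g (g ∷ shift (m ∸ g) ys)   ≡⟨ adjoin-∈ g _ (here refl) ⟩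
  g ∷ shift (m ∸ g) ys              ≡⟨ sym (adjoin-below g _ (All.map⁺ (All.map above m<ys))) ⟩
  adjoin g (shift (m ∸ g) ys)       ∎
  where
  open ≡-Reasoning
  above : ∀ {y} → m < y → g < y ∸ (m ∸ g)
  above {y} m<y = subst (_< y ∸ (m ∸ g)) (m∸[m∸n]≡n g≤m) (∸-monoˡ-< m<y (m∸n≤m m g))

-- The effect of a prefix a on f: with g = gcd a and o = f a − g, running R through a
-- leaves g in front of the tail c shifted down by o (entries of c being ≥ f a).
AppendFormula : List ℕ → List ℕ → Set
AppendFormula a c = f (a ++ c) ≡ (f a ∸ gcdL a) + f (adjoin (gcdL a) (shift (f a ∸ gcdL a) c))

-- One application of R to the prefix a₁ ∷ a₂ ∷ as reduces the formula to the prefix R(a).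
append-step : ∀ K →
  (∀ a c → ¬ a ≡ [] → Admissible (a ++ c) → All (_≤ K) (a ++ c) → All (f a ≤_) c →
     AppendFormula a c) →
  ∀ a₁ a₂ as c → Admissible (a₁ ∷ a₂ ∷ as ++ c) → All (_≤ suc K) (a₁ ∷ a₂ ∷ as ++ c) →
  All (f (a₁ ∷ a₂ ∷ as) ≤_) c → AppendFormula (a₁ ∷ a₂ ∷ as) c
append-step K append a₁ a₂ as c ad bd f≤c = byCases (adjoin-++ a₁ A′ C′ incA′C′ m≤C′ a₁≤m)
  where
  open ≡-Reasoning
  q : List ℕ
  q = a₁ ∷ a₂ ∷ as
  A′ C′ : List ℕ
  A′ = shift a₁ (a₂ ∷ as)
  C′ = shift a₁ c
  adq : Admissible q
  adq = Admissible-++ˡ q ad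
  Rq : List ℕ
  Rq = R q
  m g o : ℕ
  m = f Rq
  g = gcdL Rq
  o = m ∸ g
  adRq : Admissible Rq
  adRq = R-Admissible a₁ a₂ as adq
  f-q : f q ≡ a₁ + m
  f-q = f-unfold a₁ a₂ as adq
  g≤m : g ≤ m
  g≤m = gcd≤f Rq (adjoin-nonempty a₁ A′) adRq
  o-q : f q ∸ gcdL q ≡ a₁ + o
  o-q = trans (cong₂ _∸_ f-q (sym (gcd-R a₁ a₂ as adq))) (+-∸-assoc a₁ g≤m)
  R-q++c : R (q ++ c) ≡ adjoin a₁ (A′ ++ C′)
  R-q++c = cong (adjoin a₁) (map-++ _ (a₂ ∷ as) c)
  adX : Admissible (R (q ++ c))
  adX = R-Admissible a₁ a₂ (as ++ c) ad
  bdX : All (_≤ K) (R (q ++ c))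
  bdX = R-bounded K a₁ a₂ (as ++ c) ad bd
  incA′C′ : AllPairs _<_ (A′ ++ C′)
  incA′C′ = subst (AllPairs _<_) (map-++ _ (a₂ ∷ as) c)
    (shift-AllPairs a₁ _ (AllPairs.head (proj₁ ad)) (AllPairs.tail (proj₁ ad)))
  m≤C′ : All (m ≤_) C′
  m≤C′ = shift-lowerBound c (subst (λ z → All (z ≤_) c) f-q f≤c)
  a₁≤m : a₁ ≤ m
  a₁≤m = proj₁ (All-adjoin⁻ a₁ A′ (f-upper Rq adRq))

  -- Once R(q ++ c) is exhibited as R(q) ++ ys with ys equivalent to C′, induction applies.
  reduce : ∀ ys → R (q ++ c) ≡ Rq ++ ys → All (m ≤_) ys →
    adjoin g (shift o ys) ≡ adjoin g (shift o C′) → AppendFormula q c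
  reduce ys split m≤ys same = begin
    f (q ++ c)                                     ≡⟨ f-unfold a₁ a₂ (as ++ c) ad ⟩
    a₁ + f (R (q ++ c))                            ≡⟨ cong (λ l → a₁ + f l) split ⟩
    a₁ + f (Rq ++ ys)                              ≡⟨ cong (a₁ +_) ih ⟩
    a₁ + (o + f (adjoin g (shift o ys)))           ≡⟨ cong (λ l → a₁ + (o + f l)) same ⟩
    a₁ + (o + f (adjoin g (shift o C′)))           ≡⟨ sym (+-assoc a₁ o _) ⟩
    (a₁ + o) + f (adjoin g (shift o (shift a₁ c))) ≡⟨ cong (λ l → (a₁ + o) + f (adjoin g l))
                                                          (sym (shift-+ a₁ o c)) ⟩
    (a₁ + o) + f (adjoin g (shift (a₁ + o) c))     ≡⟨ cong₂ (λ o′ g′ → o′ + f (adjoin g′ (shift o′ c)))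
                                                          (sym o-q) (gcd-R a₁ a₂ as adq) ⟩
    (f q ∸ gcdL q) + f (adjoin (gcdL q) (shift (f q ∸ gcdL q) c)) ∎
    where
    ih : f (Rq ++ ys) ≡ o + f (adjoin g (shift o ys))
    ih = append Rq ys (adjoin-nonempty a₁ A′)
           (subst Admissible split adX) (subst (All _) split bdX) m≤ys

  byCases : (adjoin a₁ (A′ ++ C′) ≡ adjoin a₁ A′ ++ C′) ⊎
            (Σ[ ys ∈ List ℕ ] C′ ≡ a₁ ∷ ys × a₁ ≡ m × adjoin a₁ (A′ ++ C′) ≡ adjoin a₁ A′ ++ ys) →
            AppendFormula q c
  byCases (inj₁ split) = reduce C′ (trans R-q++c split) m≤C′ refl
  byCases (inj₂ (ys , C′≡ , a₁≡m , split)) =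
    reduce ys (trans R-q++c split) (All.map <⇒≤ m<ys) (sym (begin
      adjoin g (shift o C′)        ≡⟨ cong (adjoin g ∘ shift o) (trans C′≡ (cong (_∷ ys) a₁≡m)) ⟩
      adjoin g (shift o (m ∷ ys))  ≡⟨ adjoin-shift-cancel g m ys g≤m m<ys ⟩
      adjoin g (shift o ys)        ∎))
    where
    m<ys : All (m <_) ys
    m<ys = subst (λ z → All (z <_) ys) a₁≡m
             (AllPairs.head (subst (AllPairs _<_) C′≡ (AllPairs-++ʳ A′ incA′C′)))

-- The prefix law, by induction on a bound K for the entries (R lowers it by one).
f-append : ∀ a c → ¬ a ≡ [] → Admissible (a ++ c) → All (f a ≤_) c → AppendFormula a c
f-append a c a≢[] ad = appendAt (maxL (a ++ c)) a c a≢[] ad (maxL-upper _ (proj₁ ad))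
  where
  appendAt : ∀ K a c → ¬ a ≡ [] → Admissible (a ++ c) → All (_≤ K) (a ++ c) →
    All (f a ≤_) c → AppendFormula a c
  appendAt K       []               c a≢[] _  _  _ = ⊥-elim (a≢[] refl)
  appendAt K       (a₁ ∷ [])        c _    ad _  _
    rewrite gcd-identityʳ a₁ | n∸n≡0 a₁ | shift-zero c =
    cong f (sym (adjoin-below a₁ c (AllPairs.head (proj₁ ad))))
  appendAt zero    (a₁ ∷ a₂ ∷ as) c _    ad bd _ = ⊥-elim (no-zero-bound ad bd)
  appendAt (suc K) (a₁ ∷ a₂ ∷ as) c _    ad bd f≤c =
    append-step K (appendAt K) a₁ a₂ as c ad bd f≤c

adjoin-unfold : ∀ g b bs → 0 < g → All (g <_) (b ∷ bs) → AllPairs _<_ (b ∷ bs) →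
  f (adjoin g (b ∷ bs)) ≡ g + f (adjoin g (shift g (b ∷ bs)))
adjoin-unfold g b bs 0<g g<B incB = begin
  f (adjoin g (b ∷ bs)) ≡⟨ cong f (adjoin-below g _ g<B) ⟩
  f (g ∷ b ∷ bs)        ≡⟨ f-unfold g b bs ((g<B ∷ incB) , 0<g ∷ All.map (<-trans 0<g) g<B) ⟩
  g + f (adjoin g (shift g (b ∷ bs))) ∎
  where open ≡-Reasoning

next-multiple : ∀ k g → 0 < g → g < suc k * g + g × suc k * g + g ∸ g ≡ k * g + g
next-multiple k g 0<g =
  ≤-<-trans (m≤m+n g (k * g)) (m<m+n _ 0<g) ,
  trans (m+n∸n≡m (suc k * g) g) (+-comm g (k * g))

shift-above : ∀ {g X} B → g ≤ X → All (X <_) B → All (X ∸ g <_) (shift g B)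
shift-above B g≤X X<B = All.map⁺ (All.map (λ X<y → ∸-monoˡ-< X<y g≤X) X<B)

multiple-alone : ∀ k g → 0 < g → f (adjoin g (k * g + g ∷ [])) ≡ k * g + g
multiple-alone zero    g 0<g = cong f (adjoin-∈ g _ (here refl))
multiple-alone (suc k) g 0<g = begin
  f (adjoin g (X ∷ []))              ≡⟨ adjoin-unfold g X [] 0<g (g<X ∷ []) ([] ∷ []) ⟩
  g + f (adjoin g (X ∸ g ∷ []))      ≡⟨ cong (λ z → g + f (adjoin g (z ∷ []))) X-g ⟩
  g + f (adjoin g (k * g + g ∷ []))  ≡⟨ cong (g +_) (multiple-alone k g 0<g) ⟩
  g + (k * g + g)                    ≡⟨ +-comm g _ ⟩
  k * g + g + g                      ≡⟨ cong (_+ g) (+-comm (k * g) g) ⟩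
  X                                  ∎
  where
  open ≡-Reasoning
  X : ℕ
  X = suc k * g + g
  g<X : g < X
  g<X = proj₁ (next-multiple k g 0<g)
  X-g : X ∸ g ≡ k * g + g
  X-g = proj₂ (next-multiple k g 0<g)

multiple-absorbed : ∀ k g b bs → 0 < g → AllPairs _<_ (b ∷ bs) → All (k * g + g <_) (b ∷ bs) →
  f (adjoin g (k * g + g ∷ b ∷ bs)) ≡ f (adjoin g (b ∷ bs))
multiple-absorbed zero    g b bs 0<g incB g<B =
  cong f (trans (adjoin-∈ g _ (here refl)) (sym (adjoin-below g _ g<B)))
multiple-absorbed (suc k) g b bs 0<g incB X<B = begin
  f (adjoin g (X ∷ B))                     ≡⟨ adjoin-unfold g X B 0<g (g<X ∷ g<B) (X<B ∷ incB) ⟩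
  g + f (adjoin g (X ∸ g ∷ shift g B))     ≡⟨ cong (λ z → g + f (adjoin g (z ∷ shift g B))) X-g ⟩
  g + f (adjoin g (k * g + g ∷ shift g B)) ≡⟨ cong (g +_) ih ⟩
  g + f (adjoin g (shift g B))             ≡⟨ sym (adjoin-unfold g b bs 0<g g<B incB) ⟩
  f (adjoin g B)                           ∎
  where
  open ≡-Reasoning
  B : List ℕ
  B = b ∷ bs
  X : ℕ
  X = suc k * g + g
  g<X : g < X
  g<X = proj₁ (next-multiple k g 0<g)
  X-g : X ∸ g ≡ k * g + g
  X-g = proj₂ (next-multiple k g 0<g)
  g<B : All (g <_) B
  g<B = All.map (<-trans g<X) X<B
  ih : f (adjoin g (k * g + g ∷ shift g B)) ≡ f (adjoin g (shift g B))
  ih = multiple-absorbed k g (b ∸ g) (shift g bs) 0<g (shift-AllPairs g B g<B incB)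
         (subst (λ z → All (z <_) (shift g B)) X-g (shift-above B (<⇒≤ g<X) X<B))

All-delete : ∀ {P : ℕ → Set} a {x b} → All P (a ++ x ∷ b) → All P (a ++ b)
All-delete a h = All.++⁺ (All.++⁻ˡ a h) (All.tail (All.++⁻ʳ a h))

AllPairs-delete : ∀ a {x b} → AllPairs _<_ (a ++ x ∷ b) → AllPairs _<_ (a ++ b)
AllPairs-delete []       (_ ∷ inc)    = inc
AllPairs-delete (y ∷ ys) (y<ys ∷ inc) = All-delete ys y<ys ∷ AllPairs-delete ys inc

Admissible-delete : ∀ a {x b} → Admissible (a ++ x ∷ b) → Admissible (a ++ b)
Admissible-delete a (inc , pos) = AllPairs-delete a inc , All-delete a pos

gcd-delete : ∀ a x l → gcdL (a ∷ʳ x) ≡ gcdL a → gcdL (a ++ x ∷ l) ≡ gcdL (a ++ l)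
gcd-delete a x l same = gcdL-cong _ _ (All-delete a) insertDivisor
  where
  insertDivisor : ∀ {d} → All (d ∣_) (a ++ l) → All (d ∣_) (a ++ x ∷ l)
  insertDivisor {d} d∣al = All.++⁺ d∣a (d∣x ∷ All.++⁻ʳ a d∣al)
    where
    d∣a : All (d ∣_) a
    d∣a = All.++⁻ˡ a d∣al
    d∣x : d ∣ x
    d∣x = ∣-trans (subst (d ∣_) (sym same) (gcdL-greatest a d∣a))
                  (All.lookup (gcdL-divides (a ∷ʳ x)) (Any.++⁺ʳ a (here refl)))

-- p = a ++ x ∷ b with the entry x redundant right after the nonempty prefix a.
record RedundantSplit (a : List ℕ) (x : ℕ) (b : List ℕ) : Set where
  field
    nonempty   : ¬ a ≡ []
    admissible : Admissible (a ++ x ∷ b)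
    gcd-same   : gcdL (a ∷ʳ x) ≡ gcdL a
    f≤x        : f a ≤ x

RedundantSplit-prefix : ∀ {a x} b c → RedundantSplit a x (b ++ c) → RedundantSplit a x b
RedundantSplit-prefix {a} {x} b c S = record
  { nonempty   = nonempty
  ; admissible = Admissible-++ˡ (a ++ x ∷ b) (subst Admissible (sym (++-assoc a (x ∷ b) c)) admissible)
  ; gcd-same   = gcd-same
  ; f≤x        = f≤x
  }
  where open RedundantSplit S

x∸[m∸g]≡[x∸m]+g : ∀ {g m x} → g ≤ m → m ≤ x → x ∸ (m ∸ g) ≡ (x ∸ m) + g
x∸[m∸g]≡[x∸m]+g {g} {m} {x} g≤m m≤x = trans (cong (_∸ (m ∸ g)) (sym x-split)) (m+n∸m≡n (m ∸ g) _)
  where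
  open ≡-Reasoning
  x-split : (m ∸ g) + ((x ∸ m) + g) ≡ x
  x-split = begin
    (m ∸ g) + ((x ∸ m) + g) ≡⟨ cong ((m ∸ g) +_) (+-comm (x ∸ m) g) ⟩
    (m ∸ g) + (g + (x ∸ m)) ≡⟨ sym (+-assoc (m ∸ g) g (x ∸ m)) ⟩
    ((m ∸ g) + g) + (x ∸ m) ≡⟨ cong (_+ (x ∸ m)) (m∸n+n≡m g≤m) ⟩
    m + (x ∸ m)             ≡⟨ m+[n∸m]≡n m≤x ⟩
    x                       ∎

module RedundantArithmetic {a x b} (S : RedundantSplit a x b) where
  open RedundantSplit S

  g o : ℕ
  g = gcdL a
  o = f a ∸ g

  admissible-a : Admissible a
  admissible-a = Admissible-++ˡ a admissible

  g-positive : 0 < g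
  g-positive = gcd-positive a nonempty admissible-a

  o≤x : o ≤ x
  o≤x = ≤-trans (m∸n≤m (f a) g) f≤x

  -- x − o is a positive multiple t·g + g of g: g divides both f a and x, and x ≥ f a = o + g.
  g∣x∸fa : g ∣ x ∸ f a
  g∣x∸fa = ∣-∸ f≤x (gcd∣f a admissible-a) g∣x
    where
    g∣x : g ∣ x
    g∣x = subst (_∣ x) gcd-same (All.lookup (gcdL-divides (a ∷ʳ x)) (Any.++⁺ʳ a (here refl)))

  t : ℕ
  t = quotient g∣x∸fa

  x∸o≡ : x ∸ o ≡ t * g + g
  x∸o≡ = trans (x∸[m∸g]≡[x∸m]+g (gcd≤f a nonempty admissible-a) f≤x) (cong (_+ g) (_∣_.equality g∣x∸fa))

f-redundant-last : ∀ {a x} → RedundantSplit a x [] → f (a ∷ʳ x) ≡ x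
f-redundant-last {a} {x} S = begin
  f (a ∷ʳ x)                         ≡⟨ f-append a (x ∷ []) nonempty admissible (f≤x ∷ []) ⟩
  o + f (adjoin g (x ∸ o ∷ []))      ≡⟨ cong (λ z → o + f (adjoin g (z ∷ []))) x∸o≡ ⟩
  o + f (adjoin g (t * g + g ∷ []))  ≡⟨ cong (o +_) (multiple-alone t g g-positive) ⟩
  o + (t * g + g)                    ≡⟨ cong (o +_) (sym x∸o≡) ⟩
  o + (x ∸ o)                        ≡⟨ m+[n∸m]≡n o≤x ⟩
  x                                  ∎
  where
  open ≡-Reasoning
  open RedundantSplit S
  open RedundantArithmetic S

f-redundant-delete : ∀ {a x b₁ bs} → RedundantSplit a x (b₁ ∷ bs) →
  f (a ++ x ∷ b₁ ∷ bs) ≡ f (a ++ b₁ ∷ bs)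
f-redundant-delete {a} {x} {b₁} {bs} S = begin
  f (a ++ x ∷ B)                         ≡⟨ f-append a (x ∷ B) nonempty admissible (f≤x ∷ fa≤B) ⟩
  o + f (adjoin g (x ∸ o ∷ shift o B))   ≡⟨ cong (λ z → o + f (adjoin g (z ∷ shift o B))) x∸o≡ ⟩
  o + f (adjoin g (t * g + g ∷ shift o B)) ≡⟨ cong (o +_) absorbed ⟩
  o + f (adjoin g (shift o B))           ≡⟨ sym (f-append a B nonempty (Admissible-delete a admissible) fa≤B) ⟩
  f (a ++ B)                             ∎
  where
  open ≡-Reasoning
  open RedundantSplit S
  open RedundantArithmetic S
  B : List ℕ
  B = b₁ ∷ bs
  adxB : Admissible (x ∷ B)
  adxB = Admissible-++ʳ a admissible
  x<B : All (x <_) B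
  x<B = AllPairs.head (proj₁ adxB)
  o<B : All (o <_) B
  o<B = All.map (≤-<-trans o≤x) x<B
  fa≤B : All (f a ≤_) B
  fa≤B = All.map (λ x<y → ≤-trans f≤x (<⇒≤ x<y)) x<B
  absorbed : f (adjoin g (t * g + g ∷ shift o B)) ≡ f (adjoin g (shift o B))
  absorbed = multiple-absorbed t g (b₁ ∸ o) (shift o bs) g-positive
    (shift-AllPairs o B o<B (AllPairs.tail (proj₁ adxB)))
    (subst (λ z → All (z <_) (shift o B)) x∸o≡ (shift-above B o≤x x<B))

length-∷ʳ : ∀ (L : List ℕ) y → length (L ∷ʳ y) ≡ suc (length L)
length-∷ʳ []      y = refl
length-∷ʳ (_ ∷ L) y = cong suc (length-∷ʳ L y)

take-∷ʳ : ∀ (L : List ℕ) y → take (length L) (L ∷ʳ y) ≡ L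
take-∷ʳ []      y = refl
take-∷ʳ (z ∷ L) y = cong (z ∷_) (take-∷ʳ L y)

maxL-∷ʳ : ∀ (L : List ℕ) y → maxL (L ∷ʳ y) ≡ y
maxL-∷ʳ []          y = refl
maxL-∷ʳ (z ∷ [])    y = refl
maxL-∷ʳ (z ∷ w ∷ L) y = maxL-∷ʳ (w ∷ L) y

-- The test fw performs on L ∷ʳ y: is the last entry y redundant?
lastRedundant : List ℕ → ℕ → Bool
lastRedundant L y = does (2 ≤? suc (length L)) ∧ does (gcdL L ≟ gcdL (L ∷ʳ y)) ∧ does (f L ≤? y)

fw-∷ʳ : ∀ L y → fw (L ∷ʳ y) ≡ (if lastRedundant L y then fw L else f (L ∷ʳ y))
fw-∷ʳ L y = trans (cong (λ n → fwFuel n (L ∷ʳ y)) (length-∷ʳ L y))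
  (step (length-∷ʳ L y) (trans (cong (λ n → take (n ∸ 1) (L ∷ʳ y)) (length-∷ʳ L y)) (take-∷ʳ L y))
        (maxL-∷ʳ L y))
  where
  step : ∀ {n T M} → n ≡ suc (length L) → T ≡ L → M ≡ y →
    (if does (2 ≤? n) ∧ does (gcdL T ≟ gcdL (L ∷ʳ y)) ∧ does (f T ≤? M)
     then fwFuel (length L) T else f (L ∷ʳ y)) ≡
    (if lastRedundant L y then fw L else f (L ∷ʳ y))
  step refl refl refl = refl

2≤suc-length : ∀ (L : List ℕ) → ¬ L ≡ [] → 2 ≤ suc (length L)
2≤suc-length []      L≢[] = ⊥-elim (L≢[] refl)
2≤suc-length (_ ∷ _) _    = s≤s (s≤s z≤n)

++-nonempty : ∀ (a : List ℕ) {l} → ¬ a ≡ [] → ¬ a ++ l ≡ []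
++-nonempty []      a≢[] = ⊥-elim (a≢[] refl)
++-nonempty (_ ∷ _) _    = λ ()

lastRedundant-true : ∀ L y → ¬ L ≡ [] → gcdL (L ∷ʳ y) ≡ gcdL L → f L ≤ y → lastRedundant L y ≡ true
lastRedundant-true L y L≢[] same f≤y
  rewrite dec-true (2 ≤? suc (length L)) (2≤suc-length L L≢[])
        | dec-true (gcdL L ≟ gcdL (L ∷ʳ y)) (sym same)
        | dec-true (f L ≤? y) f≤y = refl

lastRedundant-cong : ∀ {L L′} y → ¬ L ≡ [] → ¬ L′ ≡ [] → gcdL L ≡ gcdL L′ →
  gcdL (L ∷ʳ y) ≡ gcdL (L′ ∷ʳ y) → does (f L ≤? y) ≡ does (f L′ ≤? y) →
  lastRedundant L y ≡ lastRedundant L′ y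
lastRedundant-cong {L} {L′} y L≢[] L′≢[] gcd≡ gcd∷ʳ≡ f≤y≡
  rewrite dec-true (2 ≤? suc (length L)) (2≤suc-length L L≢[])
        | dec-true (2 ≤? suc (length L′)) (2≤suc-length L′ L′≢[])
        | gcd≡ | gcd∷ʳ≡ | f≤y≡ = refl

-- Whether an entry y after the redundant x passes fw's third test does not depend on x:
-- right after x both tests pass, further on the two values of f agree.
f≤-after-redundant : ∀ {a x} b y → RedundantSplit a x (b ∷ʳ y) →
  does (f (a ++ x ∷ b) ≤? y) ≡ does (f (a ++ b) ≤? y)
f≤-after-redundant {a} {x} [] y S =
  trans (dec-true (f (a ∷ʳ x) ≤? y) f[a∷ʳx]≤y) (sym (dec-true (f (a ++ []) ≤? y) f[a]≤y))
  where
  open RedundantSplit S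
  x≤y : x ≤ y
  x≤y = <⇒≤ (All.head (AllPairs.head (proj₁ (Admissible-++ʳ a admissible))))
  f[a∷ʳx]≤y : f (a ∷ʳ x) ≤ y
  f[a∷ʳx]≤y = subst (_≤ y) (sym (f-redundant-last (RedundantSplit-prefix [] (y ∷ []) S))) x≤y
  f[a]≤y : f (a ++ []) ≤ y
  f[a]≤y = subst (λ l → f l ≤ y) (sym (++-identityʳ a)) (≤-trans f≤x x≤y)
f≤-after-redundant (b₁ ∷ bs) y S =
  cong (λ z → does (z ≤? y)) (f-redundant-delete (RedundantSplit-prefix (b₁ ∷ bs) (y ∷ []) S))

if-cong : ∀ {A : Set} {c c′ : Bool} {t t′ e e′ : A} → c ≡ c′ → t ≡ t′ → e ≡ e′ →
  (if c then t else e) ≡ (if c′ then t′ else e′)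
if-cong refl refl refl = refl

fw-delete : ∀ {a x} b → Reverse b → RedundantSplit a x b → fw (a ++ x ∷ b) ≡ fw (a ++ b)
fw-delete {a} {x} .[] [] S = begin
  fw (a ∷ʳ x)                                          ≡⟨ fw-∷ʳ a x ⟩
  (if lastRedundant a x then fw a else f (a ∷ʳ x))     ≡⟨ cong (if_then fw a else f (a ∷ʳ x))
                                                            (lastRedundant-true a x nonempty gcd-same f≤x) ⟩
  fw a                                                 ≡⟨ cong fw (sym (++-identityʳ a)) ⟩
  fw (a ++ [])                                         ∎
  where
  open ≡-Reasoning
  open RedundantSplit S
fw-delete {a} {x} .(b ∷ʳ y) (b ∶ rb ∶ʳ y) S = begin
  fw (a ++ x ∷ b ∷ʳ y)                                 ≡⟨ cong fw (sym (++-assoc a (x ∷ b) (y ∷ []))) ⟩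
  fw (P ∷ʳ y)                                          ≡⟨ fw-∷ʳ P y ⟩
  (if lastRedundant P y then fw P else f (P ∷ʳ y))     ≡⟨ if-cong same-test (fw-delete b rb S′) same-f ⟩
  (if lastRedundant Q y then fw Q else f (Q ∷ʳ y))     ≡⟨ sym (fw-∷ʳ Q y) ⟩
  fw (Q ∷ʳ y)                                          ≡⟨ cong fw (++-assoc a b (y ∷ [])) ⟩
  fw (a ++ b ∷ʳ y)                                     ∎
  where
  open ≡-Reasoning
  open RedundantSplit S
  P Q : List ℕ
  P = a ++ x ∷ b
  Q = a ++ b
  S′ : RedundantSplit a x b
  S′ = RedundantSplit-prefix b (y ∷ []) S
  -- b ∷ʳ y is never empty, so f-redundant-delete applies.
  delete-before-y : ∀ b → RedundantSplit a x (b ∷ʳ y) → f (a ++ x ∷ b ∷ʳ y) ≡ f (a ++ b ∷ʳ y)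
  delete-before-y []      = f-redundant-delete
  delete-before-y (_ ∷ _) = f-redundant-delete
  same-f : f (P ∷ʳ y) ≡ f (Q ∷ʳ y)
  same-f = begin
    f (P ∷ʳ y)          ≡⟨ cong f (++-assoc a (x ∷ b) (y ∷ [])) ⟩
    f (a ++ x ∷ b ∷ʳ y) ≡⟨ delete-before-y b S ⟩
    f (a ++ b ∷ʳ y)     ≡⟨ cong f (sym (++-assoc a b (y ∷ []))) ⟩
    f (Q ∷ʳ y)          ∎
  same-test : lastRedundant P y ≡ lastRedundant Q y
  same-test = lastRedundant-cong y (++-nonempty a nonempty) (++-nonempty a nonempty)
    (gcd-delete a x b gcd-same)
    (trans (cong gcdL (++-assoc a (x ∷ b) (y ∷ [])))
      (trans (gcd-delete a x (b ∷ʳ y) gcd-same) (cong gcdL (sym (++-assoc a b (y ∷ []))))))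
    (f≤-after-redundant b y S)

split-at : ∀ k (p : List ℕ) → suc k ≤ length p →
  p ≡ take k p ++ nth p (suc k) ∷ drop (suc k) p × take (suc k) p ≡ take k p ∷ʳ nth p (suc k)
split-at zero    (z ∷ zs) _         = refl , refl
split-at (suc k) (z ∷ zs) (s≤s k<) =
  let p≡ , take≡ = split-at k zs k< in cong (z ∷_) p≡ , cong (z ∷_) take≡

take-nonempty : ∀ k (p : List ℕ) → ¬ p ≡ [] → ¬ take (suc k) p ≡ []
take-nonempty k []      p≢[] = ⊥-elim (p≢[] refl)
take-nonempty k (_ ∷ _) _    = λ ()

proposition36 : (p : List ℕ) (j : ℕ) → OFS p → 2 ≤ j → j ≤ length p →
    Redundant p j → fw p ≡ fw (deleteAt j p)
proposition36 p (suc (suc i)) (p≢[] , pos , linked) (s≤s (s≤s _)) j≤|p| (gcd-same , f≤x) =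
  begin
    fw p            ≡⟨ cong fw p≡ ⟩
    fw (a ++ x ∷ b) ≡⟨ fw-delete b (reverseView b) split ⟩
    fw (a ++ b)     ∎
  where
  open ≡-Reasoning
  a b : List ℕ
  a = take (suc i) p
  b = drop (suc (suc i)) p
  x : ℕ
  x = nth p (suc (suc i))
  p≡ : p ≡ a ++ x ∷ b
  p≡ = proj₁ (split-at (suc i) p j≤|p|)
  split : RedundantSplit a x b
  split = record
    { nonempty   = take-nonempty i p p≢[]
    ; admissible = subst Admissible p≡ (Linked⇒AllPairs <-trans linked , pos)
    ; gcd-same   = trans (cong gcdL (sym (proj₂ (split-at (suc i) p j≤|p|)))) gcd-same
    ; f≤x        = f≤x
    }
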